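{- Let $a, b$ be distinct non-constant polynomials in $\mathbb{F}_2[z]$. Define $2\times2$ matrices $M_0(a,b) = \begin{pmatrix} 1 & a \\ a & 0\end{pmatrix}$, $M_0(b,a)=\begin{pmatrix} 1 & b \\ b & 0\end{pmatrix}$, and recursively for $k\ge1$ $$M_k(a,b) = M_{k-1}(a,b)\, M_{k-1}(b,a)^2\, M_{k-1}(a,b),\qquad M_k(b,a) = M_{k-1}(b,a)\, M_{k-1}(a,b)^2\, M_{k-1}(b,a).$$ For $k \ge 1$, $M_k(a,b)$ is symmetric; write $M_k(a,b) = \begin{pmatrix} Q_k & P_k\\ P_k & R_k\end{pmatrix}$ and $M_k(b,a) = \begin{pmatrix} \widetilde Q_k & \widetilde P_k\\ \widetilde P_k & \widetilde R_k\end{pmatrix}$. Let $\tau = 1+a+b$ and $n_k = 2^{2k-1}$. Then for every $k\ge1$, \begin{align*} Q_k + R_k &= \tau^{(2n_k+2)/3},\\ P_k + \widetilde P_k &= (1+\tau)\,\tau^{(2n_k-4)/3},\\ Q_k + \widetilde R_k &= \tau^{(2n_k-4)/3}. \end{align*}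
   Context: All computations take place in $\mathbb{F}_2[z]$ (characteristic $2$). The quantities $\widetilde Q_k,\widetilde P_k,\widetilde R_k$ are the entries of the matrix obtained from $M_k(a,b)$ by exchanging the roles of $a$ and $b$. -}

module Defs where

open import Data.Bool using (Bool; true; false; _xor_; if_then_else_)
open import Data.List using (List; []; _∷_; drop)
open import Data.List.Relation.Unary.All using (All)
open import Data.List.Relation.Unary.Any using (Any)
open import Data.Nat using (ℕ; zero; suc)
open import Relation.Binary.PropositionalEquality using (_≡_)
open import Relation.Nullary using (¬_)

-- Polynomials over F₂ = Bool (true = 1), as coefficient lists, lowest degree first.
-- Trailing zero coefficients are allowed; equality is semantic (_≈ₚ_).
Poly : Set
Poly = List Bool

0ₚ : Poly
0ₚ = []

1ₚ : Poly
1ₚ = true ∷ []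

infixl 6 _+ₚ_
infixl 7 _*ₚ_

_+ₚ_ : Poly → Poly → Poly
[]      +ₚ q       = q
(x ∷ p) +ₚ []      = x ∷ p
(x ∷ p) +ₚ (y ∷ q) = (x xor y) ∷ (p +ₚ q)

_*ₚ_ : Poly → Poly → Poly
[]      *ₚ q = []
(c ∷ p) *ₚ q = (if c then q else []) +ₚ (false ∷ (p *ₚ q))

_^ₚ_ : Poly → ℕ → Poly
p ^ₚ zero  = 1ₚ
p ^ₚ suc n = p *ₚ (p ^ₚ n)

IsZeroₚ : Poly → Set
IsZeroₚ p = All (_≡ false) p

-- equality of polynomials in F₂[z] (p = q iff p - q = p + q = 0)
infix 4 _≈ₚ_
_≈ₚ_ : Poly → Poly → Set
p ≈ₚ q = IsZeroₚ (p +ₚ q)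

NonConstant : Poly → Set
NonConstant p = Any (_≡ true) (drop 1 p)

record Mat : Set where
  constructor mat
  field
    e11 e12 e21 e22 : Poly
open Mat public

infixl 7 _*ₘ_
_*ₘ_ : Mat → Mat → Mat
mat a b c d *ₘ mat a' b' c' d' =
  mat (a *ₚ a' +ₚ b *ₚ c') (a *ₚ b' +ₚ b *ₚ d')
      (c *ₚ a' +ₚ d *ₚ c') (c *ₚ b' +ₚ d *ₚ d')

M : ℕ → Poly → Poly → Mat
M zero    a b = mat 1ₚ a a 0ₚ
M (suc k) a b = M k a b *ₘ (M k b a *ₘ M k b a) *ₘ M k a b

-- Let τ = 1 + a + b and u = 1 + τ = a + b.  For every k ≥ 1 the pair (M_k(a,b), M_k(b,a)) is
--   ( [[q, p], [p, q + s τ²]] ,  [[q + s u², p + u s], [p + u s, q + s]] )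
-- for some q, p and s = τ^(e_k).  The recursion preserves this form with s replaced by (τ s)⁴:
-- this is a polynomial identity in q, p, s, τ over 𝔽₂, checked by the ring solver.  Hence
-- e_1 = 0 and e_(k+1) = 4 (e_k + 1), i.e. 3 e_k + 4 = 4^k = 2 n_k, and the three sums in the
-- statement are s τ², u s and s.
module Submission where

open import Defs
open import Data.Nat using (ℕ; _≤_; _+_; _*_; _∸_; _^_; _/_)
open import Relation.Nullary using (¬_)
open import Data.Product using (_×_)

open import Algebra.Bundles using (CommutativeMonoid)
open import Algebra.Structures using (IsCommutativeMonoid; IsCommutativeSemiring)
import Algebra.Properties.CommutativeSemigroup as CommutativeSemigroupProperties
open import Data.Bool using (Bool; true; false; _xor_; if_then_else_)
open import Data.Bool.Properties
  using (xor-assoc; xor-comm; xor-identityʳ; xor-same) renaming (_≟_ to _≟ᵇ_)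
open import Data.Fin using (zero; suc)
open import Data.List using ([]; _∷_)
open import Data.List.Relation.Unary.All using ([]; _∷_; all?)
open import Data.Maybe using (Maybe; just; nothing)
open import Data.Nat using (zero; suc)
open import Data.Nat.DivMod using (m*n/n≡m)
import Data.Nat.Properties as ℕ
open import Data.Nat.Tactic.RingSolver using (solve-∀)
open import Data.Product using (_,_; proj₁; proj₂)
open import Data.Vec using (Vec; []; _∷_)
open import Relation.Binary.Bundles using (Setoid)
open import Relation.Binary.PropositionalEquality using (_≡_; refl; sym; trans; cong; cong₂)
open import Relation.Binary.Structures using (IsEquivalence)
import Relation.Binary.Reasoning.Setoid as SetoidReasoning
open import Relation.Nullary using (yes; no)
open import Tactic.RingSolver.Core.AlmostCommutativeRing using (AlmostCommutativeRing)

coeff : Poly → ℕ → Bool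
coeff []      n       = false
coeff (c ∷ p) zero    = c
coeff (c ∷ p) (suc n) = coeff p n

-- A record rather than a bare Π-type, so that p and q stay inferable.
infix 4 _≃_
record _≃_ (p q : Poly) : Set where
  constructor coeffwise
  field coeff-≡ : ∀ n → coeff p n ≡ coeff q n
open _≃_

≃-refl : ∀ {p} → p ≃ p
≃-refl = coeffwise λ _ → refl

≃-sym : ∀ {p q} → p ≃ q → q ≃ p
≃-sym e = coeffwise λ n → sym (coeff-≡ e n)

≃-trans : ∀ {p q r} → p ≃ q → q ≃ r → p ≃ r
≃-trans e f = coeffwise λ n → trans (coeff-≡ e n) (coeff-≡ f n)

≃-isEquivalence : IsEquivalence _≃_
≃-isEquivalence = record { refl = ≃-refl ; sym = ≃-sym ; trans = ≃-trans }

≃-setoid : Setoid _ _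
≃-setoid = record { isEquivalence = ≃-isEquivalence }

open SetoidReasoning ≃-setoid

≡⇒≃ : ∀ {p q} → p ≡ q → p ≃ q
≡⇒≃ refl = ≃-refl

IsZero⇒coeff≡false : ∀ {p} → IsZeroₚ p → ∀ n → coeff p n ≡ false
IsZero⇒coeff≡false []        n       = refl
IsZero⇒coeff≡false (c≡f ∷ z) zero    = c≡f
IsZero⇒coeff≡false (c≡f ∷ z) (suc n) = IsZero⇒coeff≡false z n

IsZero⇒[]≃ : ∀ {p} → IsZeroₚ p → [] ≃ p
IsZero⇒[]≃ z = coeffwise λ n → sym (IsZero⇒coeff≡false z n)

coeff≡false⇒IsZero : ∀ p → (∀ n → coeff p n ≡ false) → IsZeroₚ p
coeff≡false⇒IsZero []      f = []
coeff≡false⇒IsZero (c ∷ p) f = f zero ∷ coeff≡false⇒IsZero p (λ n → f (suc n))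

coeff-+ : ∀ p q n → coeff (p +ₚ q) n ≡ coeff p n xor coeff q n
coeff-+ []      q       n       = refl
coeff-+ (c ∷ p) []      n       = sym (xor-identityʳ _)
coeff-+ (c ∷ p) (d ∷ q) zero    = refl
coeff-+ (c ∷ p) (d ∷ q) (suc n) = coeff-+ p q n

≃⇒≈ₚ : ∀ {p q} → p ≃ q → p ≈ₚ q
≃⇒≈ₚ {p} {q} e = coeff≡false⇒IsZero (p +ₚ q) λ n →
  trans (coeff-+ p q n) (trans (cong (_xor coeff q n) (coeff-≡ e n)) (xor-same (coeff q n)))

+-cong : ∀ {p p′ q q′} → p ≃ p′ → q ≃ q′ → p +ₚ q ≃ p′ +ₚ q′
+-cong {p} {p′} {q} {q′} e f = coeffwise λ n →
  trans (coeff-+ p q n) (trans (cong₂ _xor_ (coeff-≡ e n) (coeff-≡ f n)) (sym (coeff-+ p′ q′ n)))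

+-assoc : ∀ p q r → (p +ₚ q) +ₚ r ≃ p +ₚ (q +ₚ r)
+-assoc p q r = coeffwise λ n → trans (coeff-+ (p +ₚ q) r n) (trans (cong (_xor coeff r n) (coeff-+ p q n))
  (trans (xor-assoc (coeff p n) _ _) (sym (trans (coeff-+ p (q +ₚ r) n) (cong (coeff p n xor_) (coeff-+ q r n))))))

+-comm : ∀ p q → p +ₚ q ≃ q +ₚ p
+-comm p q = coeffwise λ n → trans (coeff-+ p q n) (trans (xor-comm (coeff p n) _) (sym (coeff-+ q p n)))

+-identityʳ : ∀ p → p +ₚ [] ≃ p
+-identityʳ p = coeffwise λ n → trans (coeff-+ p [] n) (xor-identityʳ _)

+-self : ∀ p → p +ₚ p ≃ []
+-self p = coeffwise λ n → trans (coeff-+ p p n) (xor-same (coeff p n))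

+-isCommutativeMonoid : IsCommutativeMonoid _≃_ _+ₚ_ []
+-isCommutativeMonoid = record
  { isMonoid = record
    { isSemigroup = record
      { isMagma = record { isEquivalence = ≃-isEquivalence ; ∙-cong = +-cong }
      ; assoc   = +-assoc }
    ; identity = (λ _ → ≃-refl) , +-identityʳ }
  ; comm = +-comm }

+-commutativeMonoid : CommutativeMonoid _ _
+-commutativeMonoid = record { isCommutativeMonoid = +-isCommutativeMonoid }

open CommutativeSemigroupProperties (CommutativeMonoid.commutativeSemigroup +-commutativeMonoid)
  using (interchange)

p+[p+q]≃q : ∀ p q → p +ₚ (p +ₚ q) ≃ q
p+[p+q]≃q p q = begin
  p +ₚ (p +ₚ q) ≈⟨ ≃-sym (+-assoc p p q) ⟩
  (p +ₚ p) +ₚ q ≈⟨ +-cong (+-self p) ≃-refl ⟩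
  q             ∎

+≃[]⇒≃ : ∀ {p q} → p +ₚ q ≃ [] → p ≃ q
+≃[]⇒≃ {p} {q} e = begin
  p                   ≈⟨ ≃-sym (+-identityʳ p) ⟩
  p +ₚ []             ≈⟨ +-cong ≃-refl (≃-sym (+-self q)) ⟩
  p +ₚ (q +ₚ q)       ≈⟨ ≃-sym (+-assoc p q q) ⟩
  (p +ₚ q) +ₚ q       ≈⟨ +-cong e ≃-refl ⟩
  q                   ∎

≃⇒+≃[] : ∀ {p q} → p ≃ q → p +ₚ q ≃ []
≃⇒+≃[] {p} {q} e = ≃-trans (+-cong e ≃-refl) (+-self q)

∷-cong : ∀ {c p q} → p ≃ q → c ∷ p ≃ c ∷ q
∷-cong e = coeffwise λ { zero → refl ; (suc n) → coeff-≡ e n }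

false∷[]≃[] : false ∷ [] ≃ []
false∷[]≃[] = coeffwise λ { zero → refl ; (suc n) → refl }

scale : Bool → Poly → Poly
scale c q = if c then q else []

scale-distribˡ : ∀ c p q → scale c (p +ₚ q) ≃ scale c p +ₚ scale c q
scale-distribˡ true  p q = ≃-refl
scale-distribˡ false p q = ≃-refl

scale-xor : ∀ c d r → scale (c xor d) r ≃ scale c r +ₚ scale d r
scale-xor true  true  r = ≃-sym (+-self r)
scale-xor true  false r = ≃-sym (+-identityʳ r)
scale-xor false d     r = ≃-refl

scale-* : ∀ c q r → scale c q *ₚ r ≃ scale c (q *ₚ r)
scale-* true  q r = ≃-refl
scale-* false q r = ≃-refl

shift : Poly → Poly
shift p = false ∷ p

*-distribʳ : ∀ p q r → (p +ₚ q) *ₚ r ≃ p *ₚ r +ₚ q *ₚ r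
*-distribʳ []      q       r = ≃-refl
*-distribʳ (c ∷ p) []      r = ≃-sym (+-identityʳ _)
*-distribʳ (c ∷ p) (d ∷ q) r = begin
  scale (c xor d) r +ₚ shift ((p +ₚ q) *ₚ r)
    ≈⟨ +-cong (scale-xor c d r) (∷-cong (*-distribʳ p q r)) ⟩
  (scale c r +ₚ scale d r) +ₚ (shift (p *ₚ r) +ₚ shift (q *ₚ r))
    ≈⟨ interchange (scale c r) (scale d r) (shift (p *ₚ r)) (shift (q *ₚ r)) ⟩
  (scale c r +ₚ shift (p *ₚ r)) +ₚ (scale d r +ₚ shift (q *ₚ r)) ∎

*-distribˡ : ∀ p q r → p *ₚ (q +ₚ r) ≃ p *ₚ q +ₚ p *ₚ r
*-distribˡ []      q r = ≃-refl
*-distribˡ (c ∷ p) q r = begin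
  scale c (q +ₚ r) +ₚ shift (p *ₚ (q +ₚ r))
    ≈⟨ +-cong (scale-distribˡ c q r) (∷-cong (*-distribˡ p q r)) ⟩
  (scale c q +ₚ scale c r) +ₚ (shift (p *ₚ q) +ₚ shift (p *ₚ r))
    ≈⟨ interchange (scale c q) (scale c r) (shift (p *ₚ q)) (shift (p *ₚ r)) ⟩
  (scale c q +ₚ shift (p *ₚ q)) +ₚ (scale c r +ₚ shift (p *ₚ r)) ∎

≃[]⇒*≃[] : ∀ {p} q → p ≃ [] → p *ₚ q ≃ []
≃[]⇒*≃[] {[]}    q e = ≃-refl
≃[]⇒*≃[] {c ∷ p} q e with coeff-≡ e zero
... | refl = ≃-trans (∷-cong (≃[]⇒*≃[] {p} q (coeffwise λ n → coeff-≡ e (suc n)))) false∷[]≃[]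

*-congˡ : ∀ {p p′} q → p ≃ p′ → p *ₚ q ≃ p′ *ₚ q
*-congˡ {p} {p′} q e =
  +≃[]⇒≃ (≃-trans (≃-sym (*-distribʳ p p′ q)) (≃[]⇒*≃[] q (≃⇒+≃[] e)))

*-zeroʳ : ∀ p → p *ₚ [] ≃ []
*-zeroʳ []          = ≃-refl
*-zeroʳ (true ∷ p)  = ≃-trans (∷-cong (*-zeroʳ p)) false∷[]≃[]
*-zeroʳ (false ∷ p) = ≃-trans (∷-cong (*-zeroʳ p)) false∷[]≃[]

*-identityʳ : ∀ p → p *ₚ 1ₚ ≃ p
*-identityʳ []          = ≃-refl
*-identityʳ (true ∷ p)  = ∷-cong (*-identityʳ p)
*-identityʳ (false ∷ p) = ∷-cong (*-identityʳ p)

*-shiftʳ : ∀ p q → p *ₚ shift q ≃ shift (p *ₚ q)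
*-shiftʳ []          q = ≃-sym false∷[]≃[]
*-shiftʳ (true ∷ p)  q = ∷-cong (+-cong (≃-refl {q}) (*-shiftʳ p q))
*-shiftʳ (false ∷ p) q = ∷-cong (*-shiftʳ p q)

*-scaleʳ : ∀ d p → p *ₚ scale d 1ₚ ≃ scale d p
*-scaleʳ true  p = *-identityʳ p
*-scaleʳ false p = *-zeroʳ p

∷≡scale+shift : ∀ d q → d ∷ q ≡ scale d 1ₚ +ₚ shift q
∷≡scale+shift true  q = refl
∷≡scale+shift false q = refl

*-∷ʳ : ∀ p d q → p *ₚ (d ∷ q) ≃ scale d p +ₚ shift (p *ₚ q)
*-∷ʳ p d q = begin
  p *ₚ (d ∷ q)                        ≡⟨ cong (p *ₚ_) (∷≡scale+shift d q) ⟩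
  p *ₚ (scale d 1ₚ +ₚ shift q)        ≈⟨ *-distribˡ p _ _ ⟩
  p *ₚ scale d 1ₚ +ₚ p *ₚ shift q     ≈⟨ +-cong (*-scaleʳ d p) (*-shiftʳ p q) ⟩
  scale d p +ₚ shift (p *ₚ q)         ∎

*-comm : ∀ p q → p *ₚ q ≃ q *ₚ p
*-comm []      q = ≃-sym (*-zeroʳ q)
*-comm (c ∷ p) q = begin
  scale c q +ₚ shift (p *ₚ q) ≈⟨ +-cong (≃-refl {scale c q}) (∷-cong (*-comm p q)) ⟩
  scale c q +ₚ shift (q *ₚ p) ≈⟨ ≃-sym (*-∷ʳ q c p) ⟩
  q *ₚ (c ∷ p)                ∎

*-congʳ : ∀ p {q q′} → q ≃ q′ → p *ₚ q ≃ p *ₚ q′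
*-congʳ p {q} {q′} e = ≃-trans (*-comm p q) (≃-trans (*-congˡ p e) (*-comm q′ p))

*-cong : ∀ {p p′ q q′} → p ≃ p′ → q ≃ q′ → p *ₚ q ≃ p′ *ₚ q′
*-cong {p} {p′} {q} {q′} e f = ≃-trans (*-congˡ q e) (*-congʳ p′ f)

*-assoc : ∀ p q r → (p *ₚ q) *ₚ r ≃ p *ₚ (q *ₚ r)
*-assoc []      q r = ≃-refl
*-assoc (c ∷ p) q r = begin
  (scale c q +ₚ shift (p *ₚ q)) *ₚ r      ≈⟨ *-distribʳ (scale c q) (shift (p *ₚ q)) r ⟩
  scale c q *ₚ r +ₚ shift (p *ₚ q) *ₚ r   ≈⟨ +-cong (scale-* c q r) (∷-cong (*-assoc p q r)) ⟩
  scale c (q *ₚ r) +ₚ shift (p *ₚ (q *ₚ r)) ∎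

*-identityˡ : ∀ p → 1ₚ *ₚ p ≃ p
*-identityˡ p = ≃-trans (+-cong (≃-refl {p}) false∷[]≃[]) (+-identityʳ p)

+-*-isCommutativeSemiring : IsCommutativeSemiring _≃_ _+ₚ_ _*ₚ_ [] 1ₚ
+-*-isCommutativeSemiring = record
  { isSemiring = record
    { isSemiringWithoutAnnihilatingZero = record
      { +-isCommutativeMonoid = +-isCommutativeMonoid
      ; *-cong     = *-cong
      ; *-assoc    = *-assoc
      ; *-identity = *-identityˡ , *-identityʳ
      ; distrib    = *-distribˡ , λ r p q → *-distribʳ p q r }
    ; zero = (λ _ → ≃-refl) , *-zeroʳ }
  ; *-comm = *-comm }

^-+ : ∀ x m n → x ^ₚ (m + n) ≃ x ^ₚ m *ₚ x ^ₚ n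
^-+ x zero    n = ≃-sym (*-identityˡ (x ^ₚ n))
^-+ x (suc m) n = begin
  x *ₚ x ^ₚ (m + n)          ≈⟨ *-congʳ x (^-+ x m n) ⟩
  x *ₚ (x ^ₚ m *ₚ x ^ₚ n)    ≈⟨ ≃-sym (*-assoc x (x ^ₚ m) (x ^ₚ n)) ⟩
  x *ₚ x ^ₚ m *ₚ x ^ₚ n      ∎

^-* : ∀ x m n → x ^ₚ (m * n) ≃ (x ^ₚ n) ^ₚ m
^-* x zero    n = ≃-refl
^-* x (suc m) n = ≃-trans (^-+ x n (m * n)) (*-congʳ (x ^ₚ n) (^-* x m n))

[]≟_ : (p : Poly) → Maybe ([] ≃ p)
[]≟ p with all? (_≟ᵇ false) p
... | yes z = just (IsZero⇒[]≃ z)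
... | no  _ = nothing

-- In characteristic 2 negation is the identity.
𝔽₂[z] : AlmostCommutativeRing _ _
𝔽₂[z] = record
  { Carrier = Poly ; _≈_ = _≃_ ; _+_ = _+ₚ_ ; _*_ = _*ₚ_ ; -_ = λ p → p ; 0# = [] ; 1# = 1ₚ ; 0≟_ = []≟_
  ; isAlmostCommutativeRing = record
    { isCommutativeSemiring = +-*-isCommutativeSemiring
    ; -‿cong       = λ e → e
    ; -‿*-distribˡ = λ _ _ → ≃-refl
    ; -‿+-comm     = λ _ _ → ≃-refl } }

open import Tactic.RingSolver.NonReflective 𝔽₂[z] using (Expr; Κ; Ι; _⊕_; _⊗_; module Ops)
open Ops using (⟦_⟧; ⟦_⇓⟧; prove)

infix 4 _≃ₘ_
record _≃ₘ_ (X Y : Mat) : Set where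
  constructor entrywise
  field
    ≃₁₁ : e11 X ≃ e11 Y
    ≃₁₂ : e12 X ≃ e12 Y
    ≃₂₁ : e21 X ≃ e21 Y
    ≃₂₂ : e22 X ≃ e22 Y
open _≃ₘ_

≃ₘ-refl : ∀ {X} → X ≃ₘ X
≃ₘ-refl = entrywise ≃-refl ≃-refl ≃-refl ≃-refl

≃ₘ-trans : ∀ {X Y Z} → X ≃ₘ Y → Y ≃ₘ Z → X ≃ₘ Z
≃ₘ-trans (entrywise a b c d) (entrywise a′ b′ c′ d′) =
  entrywise (≃-trans a a′) (≃-trans b b′) (≃-trans c c′) (≃-trans d d′)

*ₘ-cong : ∀ {X X′ Y Y′} → X ≃ₘ X′ → Y ≃ₘ Y′ → X *ₘ Y ≃ₘ X′ *ₘ Y′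
*ₘ-cong (entrywise a b c d) (entrywise a′ b′ c′ d′) =
  entrywise (+-cong (*-cong a a′) (*-cong b c′)) (+-cong (*-cong a b′) (*-cong b d′))
            (+-cong (*-cong c a′) (*-cong d c′)) (+-cong (*-cong c b′) (*-cong d d′))

record Matᴱ (n : ℕ) : Set where
  constructor matᴱ
  field
    f11 f12 f21 f22 : Expr Poly n
open Matᴱ

infixl 7 _*ᴱ_
_*ᴱ_ : ∀ {n} → Matᴱ n → Matᴱ n → Matᴱ n
matᴱ a b c d *ᴱ matᴱ a′ b′ c′ d′ =
  matᴱ (a ⊗ a′ ⊕ b ⊗ c′) (a ⊗ b′ ⊕ b ⊗ d′) (c ⊗ a′ ⊕ d ⊗ c′) (c ⊗ b′ ⊕ d ⊗ d′)

⟦_⟧ₘ ⟦_⇓⟧ₘ : ∀ {n} → Matᴱ n → Vec Poly n → Mat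
⟦ matᴱ a b c d ⟧ₘ  ρ = mat (⟦ a ⟧ ρ) (⟦ b ⟧ ρ) (⟦ c ⟧ ρ) (⟦ d ⟧ ρ)
⟦ matᴱ a b c d ⇓⟧ₘ ρ = mat (⟦ a ⇓⟧ ρ) (⟦ b ⇓⟧ ρ) (⟦ c ⇓⟧ ρ) (⟦ d ⇓⟧ ρ)

proveₘ : ∀ {n} (X Y : Matᴱ n) ρ → ⟦ X ⇓⟧ₘ ρ ≃ₘ ⟦ Y ⇓⟧ₘ ρ → ⟦ X ⟧ₘ ρ ≃ₘ ⟦ Y ⟧ₘ ρ
proveₘ (matᴱ a b c d) (matᴱ a′ b′ c′ d′) ρ (entrywise e₁₁ e₁₂ e₂₁ e₂₂) =
  entrywise (prove ρ a a′ e₁₁) (prove ρ b b′ e₁₂) (prove ρ c c′ e₂₁) (prove ρ d d′ e₂₂)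

infixr 8 _^ᴱ_
_^ᴱ_ : ∀ {n} → Expr Poly n → ℕ → Expr Poly n
e ^ᴱ zero  = Κ 1ₚ
e ^ᴱ suc k = e ⊗ e ^ᴱ k

module _ {n : ℕ} (q p s t : Expr Poly n) where
  shapeA shapeB : Matᴱ n
  shapeA = matᴱ q p p (q ⊕ s ⊗ t ^ᴱ 2)
  shapeB = matᴱ (q ⊕ s ⊗ u ^ᴱ 2) (p ⊕ u ⊗ s) (p ⊕ u ⊗ s) (q ⊕ s)
    where u = Κ 1ₚ ⊕ t

qᴱ pᴱ sᴱ tᴱ : Expr Poly 4
qᴱ = Ι zero
pᴱ = Ι (suc zero)
sᴱ = Ι (suc (suc zero))
tᴱ = Ι (suc (suc (suc zero)))

Aᴱ Bᴱ : Matᴱ 4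
Aᴱ = shapeA qᴱ pᴱ sᴱ tᴱ
Bᴱ = shapeB qᴱ pᴱ sᴱ tᴱ

A B : Poly → Poly → Poly → Poly → Mat
A q p s t = ⟦ Aᴱ ⟧ₘ (q ∷ p ∷ s ∷ t ∷ [])
B q p s t = ⟦ Bᴱ ⟧ₘ (q ∷ p ∷ s ∷ t ∷ [])

ABBA≃A : ∀ q p s t → let F = A q p s t *ₘ (B q p s t *ₘ B q p s t) *ₘ A q p s t in
  F ≃ₘ A (e11 F) (e12 F) ((t *ₚ s) ^ₚ 4) t
ABBA≃A q p s t =
  proveₘ Fᴱ (shapeA (f11 Fᴱ) (f12 Fᴱ) ((tᴱ ⊗ sᴱ) ^ᴱ 4) tᴱ) (q ∷ p ∷ s ∷ t ∷ []) ≃ₘ-refl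
  where
  Fᴱ : Matᴱ 4
  Fᴱ = Aᴱ *ᴱ (Bᴱ *ᴱ Bᴱ) *ᴱ Aᴱ

BAAB≃B : ∀ q p s t → let F = A q p s t *ₘ (B q p s t *ₘ B q p s t) *ₘ A q p s t in
  B q p s t *ₘ (A q p s t *ₘ A q p s t) *ₘ B q p s t ≃ₘ B (e11 F) (e12 F) ((t *ₚ s) ^ₚ 4) t
BAAB≃B q p s t =
  proveₘ (Bᴱ *ᴱ (Aᴱ *ᴱ Aᴱ) *ᴱ Bᴱ) (shapeB (f11 Fᴱ) (f12 Fᴱ) ((tᴱ ⊗ sᴱ) ^ᴱ 4) tᴱ)
         (q ∷ p ∷ s ∷ t ∷ []) ≃ₘ-refl
  where
  Fᴱ : Matᴱ 4
  Fᴱ = Aᴱ *ᴱ (Bᴱ *ᴱ Bᴱ) *ᴱ Aᴱ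

module _ (a b : Poly) where
  private
    aᴱ bᴱ τᴱ : Expr Poly 2
    aᴱ = Ι zero
    bᴱ = Ι (suc zero)
    τᴱ = Κ 1ₚ ⊕ aᴱ ⊕ bᴱ
    M₀ᴱ : Expr Poly 2 → Matᴱ 2
    M₀ᴱ x = matᴱ (Κ 1ₚ) x x (Κ 0ₚ)
    M₁ᴱ : Matᴱ 2
    M₁ᴱ = M₀ᴱ aᴱ *ᴱ (M₀ᴱ bᴱ *ᴱ M₀ᴱ bᴱ) *ᴱ M₀ᴱ aᴱ

  M₁≃A : let X = M 1 a b in X ≃ₘ A (e11 X) (e12 X) 1ₚ (1ₚ +ₚ a +ₚ b)
  M₁≃A = proveₘ M₁ᴱ (shapeA (f11 M₁ᴱ) (f12 M₁ᴱ) (Κ 1ₚ) τᴱ) (a ∷ b ∷ []) ≃ₘ-refl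

  M₁≃B : let X = M 1 a b in M 1 b a ≃ₘ B (e11 X) (e12 X) 1ₚ (1ₚ +ₚ a +ₚ b)
  M₁≃B = proveₘ (M₀ᴱ bᴱ *ᴱ (M₀ᴱ aᴱ *ᴱ M₀ᴱ aᴱ) *ᴱ M₀ᴱ bᴱ) (shapeB (f11 M₁ᴱ) (f12 M₁ᴱ) (Κ 1ₚ) τᴱ)
                (a ∷ b ∷ []) ≃ₘ-refl

A-cong : ∀ {q q′ p p′ s s′} t → q ≃ q′ → p ≃ p′ → s ≃ s′ → A q p s t ≃ₘ A q′ p′ s′ t
A-cong t q≃ p≃ s≃ = entrywise q≃ p≃ p≃ (+-cong q≃ (*-congˡ (t ^ₚ 2) s≃))

B-cong : ∀ {q q′ p p′ s s′} t → q ≃ q′ → p ≃ p′ → s ≃ s′ → B q p s t ≃ₘ B q′ p′ s′ t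
B-cong t q≃ p≃ s≃ =
  entrywise (+-cong q≃ (*-congˡ ((1ₚ +ₚ t) ^ₚ 2) s≃)) (+-cong p≃ (*-congʳ (1ₚ +ₚ t) s≃))
            (+-cong p≃ (*-congʳ (1ₚ +ₚ t) s≃)) (+-cong q≃ s≃)

-- E j = e_(j+1).
E : ℕ → ℕ
E zero    = 0
E (suc j) = 4 * suc (E j)

Shaped : ℕ → Poly → Poly → Set
Shaped j a b = M (suc j) a b ≃ₘ A q p s τ × M (suc j) b a ≃ₘ B q p s τ
  where
  τ = 1ₚ +ₚ a +ₚ b
  q = e11 (M (suc j) a b)
  p = e12 (M (suc j) a b)
  s = τ ^ₚ E j

shaped-suc : ∀ j a b → Shaped j a b → Shaped (suc j) a b
shaped-suc j a b (M≃A , M̃≃B) =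
  ≃ₘ-trans M′≃ABBA (≃ₘ-trans (ABBA≃A q p s τ) (A-cong τ q≃ p≃ s≃)) ,
  ≃ₘ-trans M̃′≃BAAB (≃ₘ-trans (BAAB≃B q p s τ) (B-cong τ q≃ p≃ s≃))
  where
  τ = 1ₚ +ₚ a +ₚ b
  q = e11 (M (suc j) a b)
  p = e12 (M (suc j) a b)
  s = τ ^ₚ E j
  M′≃ABBA : M (suc (suc j)) a b ≃ₘ A q p s τ *ₘ (B q p s τ *ₘ B q p s τ) *ₘ A q p s τ
  M′≃ABBA = *ₘ-cong (*ₘ-cong M≃A (*ₘ-cong M̃≃B M̃≃B)) M≃A
  M̃′≃BAAB : M (suc (suc j)) b a ≃ₘ B q p s τ *ₘ (A q p s τ *ₘ A q p s τ) *ₘ B q p s τ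
  M̃′≃BAAB = *ₘ-cong (*ₘ-cong M̃≃B (*ₘ-cong M≃A M≃A)) M̃≃B
  q≃ : e11 (A q p s τ *ₘ (B q p s τ *ₘ B q p s τ) *ₘ A q p s τ) ≃ e11 (M (suc (suc j)) a b)
  q≃ = ≃-sym (≃₁₁ M′≃ABBA)
  p≃ : e12 (A q p s τ *ₘ (B q p s τ *ₘ B q p s τ) *ₘ A q p s τ) ≃ e12 (M (suc (suc j)) a b)
  p≃ = ≃-sym (≃₁₂ M′≃ABBA)
  s≃ : (τ *ₚ s) ^ₚ 4 ≃ τ ^ₚ E (suc j)
  s≃ = ≃-sym (^-* τ 4 (suc (E j)))

shaped : ∀ j a b → Shaped j a b
shaped zero    a b = M₁≃A a b , M₁≃B a b
shaped (suc j) a b = shaped-suc j a b (shaped j a b)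

-- 2 * suc j ∸ 1 is a successor by computation, so the left side unfolds to 2 ^ (2 * suc j).
2nₖ≡4^k : ∀ j → 2 * 2 ^ (2 * suc j ∸ 1) ≡ 4 ^ suc j
2nₖ≡4^k j = sym (ℕ.^-*-assoc 2 2 (suc j))

4^k≡3E+4 : ∀ j → 4 ^ suc j ≡ 3 * E j + 4
4^k≡3E+4 zero    = refl
4^k≡3E+4 (suc j) = trans (cong (4 *_) (4^k≡3E+4 j)) (4[3e+4]≡3[4[1+e]]+4 (E j))
  where
  4[3e+4]≡3[4[1+e]]+4 : ∀ e → 4 * (3 * e + 4) ≡ 3 * (4 * suc e) + 4
  4[3e+4]≡3[4[1+e]]+4 = solve-∀

2nₖ≡3E+4 : ∀ j → 2 * 2 ^ (2 * suc j ∸ 1) ≡ 3 * E j + 4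
2nₖ≡3E+4 j = trans (2nₖ≡4^k j) (4^k≡3E+4 j)

[2nₖ+2]/3≡E+2 : ∀ j → (2 * 2 ^ (2 * suc j ∸ 1) + 2) / 3 ≡ E j + 2
[2nₖ+2]/3≡E+2 j = trans (cong (λ m → (m + 2) / 3) (2nₖ≡3E+4 j))
  (trans (cong (_/ 3) (3e+4+2≡[e+2]*3 (E j))) (m*n/n≡m (E j + 2) 3))
  where
  3e+4+2≡[e+2]*3 : ∀ e → 3 * e + 4 + 2 ≡ (e + 2) * 3
  3e+4+2≡[e+2]*3 = solve-∀

[2nₖ∸4]/3≡E : ∀ j → (2 * 2 ^ (2 * suc j ∸ 1) ∸ 4) / 3 ≡ E j
[2nₖ∸4]/3≡E j = trans (cong (λ m → (m ∸ 4) / 3) (2nₖ≡3E+4 j))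
  (trans (cong (_/ 3) (trans (ℕ.m+n∸n≡m (3 * E j) 4) (ℕ.*-comm 3 (E j)))) (m*n/n≡m (E j) 3))

A-e11+e22 : ∀ {X} q p s t → X ≃ₘ A q p s t → e11 X +ₚ e22 X ≃ s *ₚ t ^ₚ 2
A-e11+e22 q p s t X≃A = ≃-trans (+-cong (≃₁₁ X≃A) (≃₂₂ X≃A)) (p+[p+q]≃q q _)

A-B-e12+e12 : ∀ {X Y} q p s t → X ≃ₘ A q p s t → Y ≃ₘ B q p s t → e12 X +ₚ e12 Y ≃ (1ₚ +ₚ t) *ₚ s
A-B-e12+e12 q p s t X≃A Y≃B = ≃-trans (+-cong (≃₁₂ X≃A) (≃₁₂ Y≃B)) (p+[p+q]≃q p _)

A-B-e11+e22 : ∀ {X Y} q p s t → X ≃ₘ A q p s t → Y ≃ₘ B q p s t → e11 X +ₚ e22 Y ≃ s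
A-B-e11+e22 q p s t X≃A Y≃B = ≃-trans (+-cong (≃₁₁ X≃A) (≃₂₂ Y≃B)) (p+[p+q]≃q q _)

proposition4p3 : (a b : Poly) → NonConstant a → NonConstant b → ¬ (a ≈ₚ b) →
    (k : ℕ) → 1 ≤ k →
    let τ  = 1ₚ +ₚ a +ₚ b
        nk = 2 ^ (2 * k ∸ 1)
        Mk = M k a b
        Nk = M k b a
    in (e11 Mk +ₚ e22 Mk ≈ₚ τ ^ₚ ((2 * nk + 2) / 3))
     × (e12 Mk +ₚ e12 Nk ≈ₚ (1ₚ +ₚ τ) *ₚ τ ^ₚ ((2 * nk ∸ 4) / 3))
     × (e11 Mk +ₚ e22 Nk ≈ₚ τ ^ₚ ((2 * nk ∸ 4) / 3))
proposition4p3 _ _ _ _ _ zero    ()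
proposition4p3 a b _ _ _ (suc j) _ =
  ≃⇒≈ₚ (≃-trans (A-e11+e22 q p s τ Mₖ≃A) τ^E*τ²≃) ,
  ≃⇒≈ₚ (≃-trans (A-B-e12+e12 q p s τ Mₖ≃A M̃ₖ≃B) (*-congʳ (1ₚ +ₚ τ) τ^E≃)) ,
  ≃⇒≈ₚ (≃-trans (A-B-e11+e22 q p s τ Mₖ≃A M̃ₖ≃B) τ^E≃)
  where
  τ = 1ₚ +ₚ a +ₚ b
  q = e11 (M (suc j) a b)
  p = e12 (M (suc j) a b)
  s = τ ^ₚ E j
  Mₖ≃A = proj₁ (shaped j a b)
  M̃ₖ≃B = proj₂ (shaped j a b)
  τ^E*τ²≃ : τ ^ₚ E j *ₚ τ ^ₚ 2 ≃ τ ^ₚ ((2 * 2 ^ (2 * suc j ∸ 1) + 2) / 3)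
  τ^E*τ²≃ = ≃-trans (≃-sym (^-+ τ (E j) 2)) (≡⇒≃ (cong (τ ^ₚ_) (sym ([2nₖ+2]/3≡E+2 j))))
  τ^E≃ : τ ^ₚ E j ≃ τ ^ₚ ((2 * 2 ^ (2 * suc j ∸ 1) ∸ 4) / 3)
  τ^E≃ = ≡⇒≃ (cong (τ ^ₚ_) (sym ([2nₖ∸4]/3≡E j)))
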